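{- For every integer $m\ge 3$, $\mathrm{forb}(m,F(0,3,1,0))=\lfloor \tfrac{7}{3}m\rfloor+1$.
   Context: A matrix is simple if it is a $(0,1)$-matrix with no repeated columns. For $(0,1)$-matrices $F,A$, $F$ is a configuration in $A$ (written $F\prec A$) if some submatrix of $A$ is a row and column permutation of $F$. $\mathrm{Avoid}(m,F)$ is the set of all simple $m$-rowed matrices $A$ with $F\not\prec A$, and $\mathrm{forb}(m,F)$ is the maximum number of columns of a matrix in $\mathrm{Avoid}(m,F)$. $F(0,3,1,0)$ is the $2\times 4$ matrix whose first $3$ columns are $\binom{1}{0}$ and whose last column is $\binom{0}{1}$. -}

module Defs where

open import Data.Nat using (ℕ; _≤_; _*_; _+_; _/_)
open import Data.Fin using (Fin; zero; suc)
open import Data.Bool using (Bool; true; false)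
open import Data.Product using (Σ; ∃; _×_; _,_)
open import Relation.Binary.PropositionalEquality using (_≡_)
open import Relation.Nullary using (¬_)
open import Function.Definitions using (Injective)

-- An m × n (0,1)-matrix: entry (row r, column c). true = 1, false = 0.
Matrix : ℕ → ℕ → Set
Matrix m n = Fin m → Fin n → Bool

Simple : ∀ {m n} → Matrix m n → Set
Simple {m} {n} A = ∀ (i j : Fin n) → (∀ (r : Fin m) → A r i ≡ A r j) → i ≡ j

-- F ≺ A : some submatrix of A is a row and column permutation of F, i.e.
-- there are injective row and column selections ρ, γ with F r c = A (ρ r) (γ c).
_≺_ : ∀ {k l m n} → Matrix k l → Matrix m n → Set
_≺_ {k} {l} {m} {n} F A =
  Σ (Fin k → Fin m) λ ρ → Σ (Fin l → Fin n) λ γ →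
    Injective _≡_ _≡_ ρ × Injective _≡_ _≡_ γ ×
    (∀ r c → F r c ≡ A (ρ r) (γ c))

Avoids : ∀ {k l m n} → Matrix k l → Matrix m n → Set
Avoids F A = Simple A × ¬ (F ≺ A)

ForbIs : ∀ {k l} → ℕ → Matrix k l → ℕ → Set
ForbIs m F N =
  (Σ (Matrix m N) λ A → Avoids F A) ×
  (∀ (n : ℕ) (A : Matrix m n) → Avoids F A → n ≤ N)

-- F(0,3,1,0): 2 × 4, first three columns (1,0)ᵀ, last column (0,1)ᵀ.
F0310 : Matrix 2 4
F0310 zero    (suc (suc (suc zero))) = false
F0310 zero    _                      = true
F0310 (suc zero) (suc (suc (suc zero))) = true
F0310 (suc zero) _                   = false

module Submission where

open import Defs
open import Data.Bool using (Bool; true; false; not)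
open import Data.Bool.Properties using (¬-not; not-¬) renaming (_≟_ to _≟ᵇ_)
open import Data.Empty using (⊥-elim)
open import Data.Fin using (Fin; zero; suc; #_; splitAt; _↑ˡ_; _↑ʳ_)
open import Data.Fin.Properties using (all?; splitAt-↑ˡ; splitAt-↑ʳ) renaming (_≟_ to _≟ᶠ_)
open import Data.List using (List; []; _∷_; _++_; length; map; filter; allFin; lookup)
open import Data.List.Properties
  using (filter-none; filter-all; filter-some; filter-notAll; filter-++; filter-≐;
         length-++; length-map; length-tabulate; map-tabulate; tabulate-lookup)
open import Data.List.Membership.Propositional using (_∈_; lose; find)
open import Data.List.Membership.Propositional.Properties using (∈-filter⁺; ∈-filter⁻; ∈-allFin; ∈-lookup)
open import Data.List.Relation.Binary.Sublist.Propositional using (_⊆_; ⊆-trans)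
open import Data.List.Relation.Binary.Sublist.Propositional.Properties
  using (filter⁺; filter-⊆) renaming (length-mono-≤ to ⊆-length-≤)
open import Data.List.Relation.Unary.All as All using (All; []; _∷_)
import Data.List.Relation.Unary.All.Properties as All
open import Data.List.Relation.Unary.All.Properties using (all-filter; ¬All⇒Any¬; ¬Any⇒All¬; All¬⇒¬Any)
open import Data.List.Relation.Unary.AllPairs as AllPairs using (AllPairs; []; _∷_; allPairs?)
import Data.List.Relation.Unary.AllPairs.Properties as AllPairs
open import Data.List.Relation.Unary.Any as Any using (Any; here; there; any?)
import Data.List.Relation.Unary.Any.Properties as Any
open import Data.List.Relation.Unary.Unique.Propositional using (Unique)
import Data.List.Relation.Unary.Unique.Propositional.Properties as Unique
open import Data.Nat using (ℕ; zero; suc; _+_; _*_; _/_; _^_; _≤_; _<_; z≤n; s≤s; _≤?_; _≟_)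
open import Data.Nat.Properties
open import Data.Nat.DivMod using (m*n/n≡m; /-monoˡ-≤; +-distrib-/-∣ʳ)
open import Data.Nat.Divisibility using (divides-refl)
open import Data.Nat.Tactic.RingSolver using (solve-∀)
open import Data.Product using (Σ; ∃; _×_; _,_; proj₁; proj₂)
open import Data.Sum using (_⊎_; inj₁; inj₂; [_,_]′)
import Data.Sum as Sum
open import Data.Vec using ([]; _∷_)
import Data.Vec as Vec
open import Data.Vec.Relation.Unary.All using ([]; _∷_)
open import Data.Vec.Relation.Unary.AllPairs using ([]; _∷_)
import Data.Vec.Relation.Unary.Unique.Propositional.Properties as VecUnique
open import Function using (_∘_; case_of_; id)
open import Level using (0ℓ)
open import Relation.Binary using (Rel; DecidableEquality; IsDecPreorder)
open import Relation.Binary.PropositionalEquality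
open import Relation.Nullary using (Dec; ¬_; yes; no; ¬?; does)
open import Relation.Nullary.Decidable using (_×-dec_; _→-dec_; decidable-stable; from-yes)
open import Relation.Unary using (Pred; Decidable; ∁)
open import Relation.Unary.Properties using (∁?)

-- Write #10 i j for the number of columns with a 1 in row i and a 0 in row j, and
-- i ≼ j when row j has a 1 wherever row i has. Avoiding F(0,3,1,0) says that #10 i j ≥ 3 forces
-- j ≼ i, so #10 i j ≤ 2 whenever j is not strictly below i. Layering the rows by minimal elements
-- gives a partner map x ↦ x′ that never points strictly below x and such that every column
-- which is closed (a 1 at x forces a 1 at x′) and not constant cuts the rows: each row where it
-- is 0 lies below each row where it is 1. If some column cuts, the columns split into those
-- vanishing on the lower rows (distinct on the upper rows) and the rest (all 1 on the upper rows,
-- hence distinct on the lower rows), and induction applies to both halves. Otherwise every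
-- non-constant column has a 1 at some x and a 0 at x′, so there are at most 2m of them, and
-- n ≤ 2m + 2 ≤ (7m + 3)/3 once m ≥ 3.
--
-- For m = 3, 4, 5 the 2m + 2 columns of weight ≤ 1 or ≥ m − 1 work, and from an
-- m-rowed example A one gets the (m + 3)-rowed example [E 1; 0 A], where E consists of the seven
-- columns on three rows other than (1,1,1).

private variable
  A B : Set

count : {P : Pred A 0ℓ} → Decidable P → List A → ℕ
count P? xs = length (filter P? xs)

count-map : {P : Pred A 0ℓ} (P? : Decidable P) (f : B → A) → ∀ xs →
            count P? (map f xs) ≡ count (P? ∘ f) xs
count-map P? f [] = refl
count-map P? f (x ∷ xs) with P? (f x)
... | yes _ = cong suc (count-map P? f xs)
... | no _ = count-map P? f xs

module _ {A : Set} where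

  private variable
    P Q : Pred A 0ℓ
    R S : Rel A 0ℓ
    xs ys : List A

  count-partition : (P? : Decidable P) → ∀ xs → length xs ≡ count P? xs + count (∁? P?) xs
  count-partition P? [] = refl
  count-partition P? (x ∷ xs) with P? x
  ... | yes _ = cong suc (count-partition P? xs)
  ... | no _ = trans (cong suc (count-partition P? xs)) (sym (+-suc _ _))

  count-++ : (P? : Decidable P) → ∀ xs ys → count P? (xs ++ ys) ≡ count P? xs + count P? ys
  count-++ P? xs ys = trans (cong length (filter-++ P? xs ys)) (length-++ (filter P? xs))

  count-⊆ : (P? : Decidable P) → xs ⊆ ys → count P? xs ≤ count P? ys
  count-⊆ P? xs⊆ys = ⊆-length-≤ (filter⁺ P? P? (λ { refl p → p }) xs⊆ys)

  count-mono : (P? : Decidable P) (Q? : Decidable Q) → ∀ xs →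
               (∀ {x} → x ∈ xs → P x → Q x) → count P? xs ≤ count Q? xs
  count-mono P? Q? [] _ = z≤n
  count-mono P? Q? (x ∷ xs) P⇒Q with P? x | Q? x
  ... | yes _ | yes _ = s≤s (count-mono P? Q? xs (P⇒Q ∘ there))
  ... | yes p | no ¬q = ⊥-elim (¬q (P⇒Q (here refl) p))
  ... | no _ | yes _ = m≤n⇒m≤1+n (count-mono P? Q? xs (P⇒Q ∘ there))
  ... | no _ | no _ = count-mono P? Q? xs (P⇒Q ∘ there)

  count≡0⇒All¬ : (P? : Decidable P) → ∀ xs → count P? xs ≡ 0 → All (∁ P) xs
  count≡0⇒All¬ P? xs count≡0 = All.tabulate λ x∈xs px →
    <-irrefl (sym count≡0) (filter-some P? (lose x∈xs px))

  count≤1 : (P? : Decidable P) → (∀ {x y} → P x → P y → ¬ R x y) → AllPairs R xs → count P? xs ≤ 1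
  count≤1 {P} {R} {xs} P? ¬R rxs = at-most-one (all-filter P? xs) (AllPairs.filter⁺ P? rxs)
    where
    at-most-one : ∀ {ys} → All P ys → AllPairs R ys → length ys ≤ 1
    at-most-one [] _ = z≤n
    at-most-one (_ ∷ []) _ = s≤s z≤n
    at-most-one (px ∷ py ∷ _) ((r ∷ _) ∷ _) = ⊥-elim (¬R px py r)

  module _ {I : Set} {P : I → Pred A 0ℓ} (P? : ∀ i → Decidable (P i)) where

    cover-length≤ : ∀ k is xs → (∀ {i} → i ∈ is → count (P? i) xs ≤ k) →
                    All (λ x → Any (λ i → P i x) is) xs → length xs ≤ length is * k
    cover-length≤ k [] [] _ _ = z≤n
    cover-length≤ k [] (_ ∷ _) _ (() ∷ _)
    cover-length≤ k (i ∷ is) xs count≤k covered = begin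
      length xs                      ≡⟨ count-partition (P? i) xs ⟩
      count (P? i) xs + length rest  ≤⟨ +-mono-≤ (count≤k (here refl)) rest≤ ⟩
      k + length is * k              ∎
      where
      open ≤-Reasoning
      rest = filter (∁? (P? i)) xs
      covered-by-is : ∀ {x} → Any (λ j → P j x) (i ∷ is) → ¬ P i x → Any (λ j → P j x) is
      covered-by-is (here p) ¬p = ⊥-elim (¬p p)
      covered-by-is (there a) _ = a
      rest≤ : length rest ≤ length is * k
      rest≤ = cover-length≤ k is rest
        (λ j∈is → ≤-trans (count-⊆ (P? _) (filter-⊆ (∁? (P? i)) xs)) (count≤k (there j∈is)))
        (All.tabulate λ x∈rest → let x∈xs , ¬Pix = ∈-filter⁻ (∁? (P? i)) x∈rest in
          covered-by-is (All.lookup covered x∈xs) ¬Pix)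

  Any-filter⁺ : (Q? : Decidable Q) → (∀ {x} → x ∈ xs → P x → Q x) → Any P xs → Any P (filter Q? xs)
  Any-filter⁺ Q? P⇒Q any =
    let x , x∈xs , px = find any in lose (∈-filter⁺ Q? x∈xs (P⇒Q x∈xs px)) px

  AllPairs-restrict : All P xs → (∀ {x y} → P x → P y → R x y → S x y) → AllPairs R xs → AllPairs S xs
  AllPairs-restrict [] _ [] = []
  AllPairs-restrict (px ∷ pxs) R⇒S (rx ∷ rxs) =
    All.zipWith (λ (py , r) → R⇒S px py r) (pxs , rx) ∷ AllPairs-restrict pxs R⇒S rxs

  module _ (_≟_ : DecidableEquality A) where

    Unique⇒length≤ : Unique xs → (∀ {x} → x ∈ xs → x ∈ ys) → length xs ≤ length ys
    Unique⇒length≤ [] _ = z≤n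
    Unique⇒length≤ {x ∷ xs} {ys} (x∉xs ∷ unique) xs⊆ys = begin-strict
      length xs               ≤⟨ Unique⇒length≤ unique (λ y∈xs →
                                   ∈-filter⁺ ≢x? (xs⊆ys (there y∈xs)) (All.lookup x∉xs y∈xs)) ⟩
      length (filter ≢x? ys)  <⟨ filter-notAll ≢x? ys (lose (xs⊆ys (here refl)) (λ x≢x → x≢x refl)) ⟩
      length ys               ∎
      where
      open ≤-Reasoning
      ≢x? : Decidable (x ≢_)
      ≢x? = ¬? ∘ (x ≟_)

¬[⇒true]⇒true-false : ∀ {a b} → ¬ (a ≡ true → b ≡ true) → a ≡ true × b ≡ false
¬[⇒true]⇒true-false {true} {false} _ = refl , refl
¬[⇒true]⇒true-false {true} {true} ¬imp = ⊥-elim (¬imp λ _ → refl)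
¬[⇒true]⇒true-false {false} ¬imp = ⊥-elim (¬imp λ ())

-- Minimal layers of a finite preorder

module MinimalLayers {X : Set} {_≼_ : Rel X 0ℓ} (isDecPreorder : IsDecPreorder _≡_ _≼_) where

  open IsDecPreorder isDecPreorder using ()
    renaming (_≟_ to _≟ˣ_; _≲?_ to _≼?_; refl to ≼-refl; trans to ≼-trans)

  Minimal : List X → Pred X 0ℓ
  Minimal W x = All (λ y → y ≼ x → x ≼ y) W

  minimal? : ∀ W → Decidable (Minimal W)
  minimal? W x = All.all? (λ y → (y ≼? x) →-dec (x ≼? y)) W

  minimals nonminimals : List X → List X
  minimals W = filter (minimal? W) W
  nonminimals W = filter (∁? (minimal? W)) W

  minimal-below : ∀ W t → ∃ λ y → (y ≡ t ⊎ y ∈ W) × y ≼ t × Minimal (t ∷ W) y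
  minimal-below [] t = t , inj₁ refl , ≼-refl , (λ _ → ≼-refl) ∷ []
  minimal-below (w ∷ W) t with minimal-below W t
  ... | y , y∈ , y≼t , minᵗ ∷ minᵂ with w ≼? y | y ≼? w
  ...   | yes w≼y | no y⋠w =
          let z , z∈ , z≼w , minᶻ = minimal-below W w
              z≼t = ≼-trans z≼w (≼-trans w≼y y≼t)
          in z , inj₂ ([ here , there ]′ z∈) , z≼t , (λ _ → z≼t) ∷ minᶻ
  ...   | yes _ | yes y≼w = y , Sum.map₂ there y∈ , y≼t , minᵗ ∷ (λ _ → y≼w) ∷ minᵂ
  ...   | no w⋠y | _ = y , Sum.map₂ there y∈ , y≼t , minᵗ ∷ (⊥-elim ∘ w⋠y) ∷ minᵂ

  minimals-cover : ∀ {W t} → t ∈ W → ∃ λ y → y ∈ minimals W × y ≼ t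
  minimals-cover {W} {t} t∈W with minimal-below W t
  ... | y , y∈ , y≼t , _ ∷ minʸ =
        y , ∈-filter⁺ (minimal? W) ([ (λ { refl → t∈W }) , id ]′ y∈) minʸ , y≼t

  head-or : X → List X → X
  head-or h [] = h
  head-or h (y ∷ _) = y

  next : X → List X → X → X
  next h [] x = h
  next h (y ∷ ys) x with x ≟ˣ y
  ... | yes _ = head-or h ys
  ... | no _ = next h ys x

  next-here : ∀ h y ys → next h (y ∷ ys) y ≡ head-or h ys
  next-here h y ys with y ≟ˣ y
  ... | yes _ = refl
  ... | no y≢y = ⊥-elim (y≢y refl)

  next-there : ∀ h {y} ys {x} → x ≢ y → next h (y ∷ ys) x ≡ next h ys x
  next-there h {y} ys {x} x≢y with x ≟ˣ y
  ... | yes x≡y = ⊥-elim (x≢y x≡y)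
  ... | no _ = refl

  next-∈ : ∀ h ys x → next h ys x ∈ h ∷ ys
  next-∈ h [] x = here refl
  next-∈ h (y ∷ ys) x with x ≟ˣ y
  next-∈ h (y ∷ []) x | yes _ = here refl
  next-∈ h (y ∷ z ∷ _) x | yes _ = there (there (here refl))
  ... | no _ with next-∈ h ys x
  ...   | here e = here e
  ...   | there p = there (there p)

  cycle : List X → X → X
  cycle [] x = x
  cycle (h ∷ t) x = next h (h ∷ t) x

  cycle-∈ : ∀ {M x} → x ∈ M → cycle M x ∈ M
  cycle-∈ {h ∷ t} {x} _ with next-∈ h (h ∷ t) x
  ... | here e = here e
  ... | there p = p

  module _ (U : Pred X 0ℓ) (h : X) where

    NextClosed : List X → Set
    NextClosed ys = ∀ {x} → x ∈ ys → U x → U (next h ys x)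

    next-closed-tail : ∀ {y ys} → Unique (y ∷ ys) → NextClosed (y ∷ ys) → NextClosed ys
    next-closed-tail {y} {ys} (y∉ys ∷ _) closed x∈ys ux =
      subst U (next-there h ys (≢-sym (All.lookup y∉ys x∈ys))) (closed (there x∈ys) ux)

    reaches-wrap : ∀ {ys} → Unique ys → NextClosed ys → ∀ {x} → x ∈ ys → U x → U h
    reaches-wrap {y ∷ []} _ closed (here refl) uy = subst U (next-here h y []) (closed (here refl) uy)
    reaches-wrap {y ∷ z ∷ zs} u@(_ ∷ u′) closed (here refl) uy =
      reaches-wrap u′ (next-closed-tail u closed) (here refl)
        (subst U (next-here h y (z ∷ zs)) (closed (here refl) uy))
    reaches-wrap u@(_ ∷ u′) closed (there x∈ys) ux = reaches-wrap u′ (next-closed-tail u closed) x∈ys ux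

    spreads : ∀ {y ys} → Unique (y ∷ ys) → NextClosed (y ∷ ys) → U y → All U (y ∷ ys)
    spreads {y} {[]} _ _ uy = uy ∷ []
    spreads {y} {z ∷ zs} u@(_ ∷ u′) closed uy =
      uy ∷ spreads u′ (next-closed-tail u closed) (subst U (next-here h y (z ∷ zs)) (closed (here refl) uy))

  cycle-closed⇒all : ∀ (U : Pred X 0ℓ) {M} → Unique M → (∀ {x} → x ∈ M → U x → U (cycle M x)) →
                     ∀ {x} → x ∈ M → U x → All U M
  cycle-closed⇒all U {h ∷ t} u closed x∈M ux = spreads U h u closed (reaches-wrap U h u closed x∈M ux)

  partner : ℕ → List X → X → X
  partner zero W x = x
  partner (suc k) W x with minimal? W x | any? (λ y → ¬? (y ≼? x)) (minimals W)
  ... | yes _ | _ = cycle (minimals W) x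
  ... | no _ | yes escape = proj₁ (find escape)
  ... | no _ | no _ = partner k (nonminimals W) x

  partner-not-below : ∀ k W {x} → x ∈ W → partner k W x ≼ x → x ≼ partner k W x
  partner-not-below zero W _ _ = ≼-refl
  partner-not-below (suc k) W {x} x∈W with minimal? W x | any? (λ y → ¬? (y ≼? x)) (minimals W)
  ... | yes minˣ | _ =
        All.lookup minˣ (proj₁ (∈-filter⁻ (minimal? W) (cycle-∈ (∈-filter⁺ (minimal? W) x∈W minˣ))))
  ... | no _ | yes escape = λ y≼x → ⊥-elim (proj₂ (proj₂ (find escape)) y≼x)
  ... | no ¬minˣ | no _ = partner-not-below k (nonminimals W) (∈-filter⁺ (∁? (minimal? W)) x∈W ¬minˣ)

  partner-minimal : ∀ k W {x} → Minimal W x → partner (suc k) W x ≡ cycle (minimals W) x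
  partner-minimal k W {x} minˣ with minimal? W x
  ... | yes _ = refl
  ... | no ¬minˣ = ⊥-elim (¬minˣ minˣ)

  module _ (U : Pred X 0ℓ) (U-up : ∀ {x y} → x ≼ y → U x → U y) where

    PartnerClosed : ℕ → List X → Set
    PartnerClosed k W = ∀ {x} → x ∈ W → U x → U (partner k W x)

    -- If U met the minimal layer, closure under the cycle would put the whole layer, and hence
    -- all of W, into U. So the layer lies outside U, closure forces every element of U above the
    -- whole layer, and the remaining layers are handled recursively.
    partner-closed⇒cut : ∀ k W → length W ≤ k → Unique W → PartnerClosed k W →
                         ∀ {t u} → t ∈ W → u ∈ W → ¬ U t → U u → t ≼ u
    partner-closed⇒cut zero [] _ _ _ ()
    partner-closed⇒cut zero (_ ∷ _) ()
    partner-closed⇒cut (suc k) W |W|≤ uW closed {t} {u} t∈W u∈W ¬ut uu = t≼u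
      where
      M = minimals W

      ¬U-minimal : ∀ {y} → y ∈ M → ¬ U y
      ¬U-minimal y∈M uy =
        let z , z∈M , z≼t = minimals-cover t∈W
            all-in-U = cycle-closed⇒all U (Unique.filter⁺ (minimal? W) uW) cycle-closed y∈M uy
        in ¬ut (U-up z≼t (All.lookup all-in-U z∈M))
        where
        cycle-closed : ∀ {x} → x ∈ M → U x → U (cycle M x)
        cycle-closed x∈M ux = let x∈W , minˣ = ∈-filter⁻ (minimal? W) x∈M in
          subst U (partner-minimal k W minˣ) (closed x∈W ux)

      climb : ∀ {x} → x ∈ W → U x →
              ¬ Minimal W x × All (_≼ x) M × partner (suc k) W x ≡ partner k (nonminimals W) x
      climb {x} x∈W ux with minimal? W x | any? (λ y → ¬? (y ≼? x)) M | closed x∈W ux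
      ... | yes minˣ | _ | _ = ⊥-elim (¬U-minimal (∈-filter⁺ (minimal? W) x∈W minˣ) ux)
      ... | no _ | yes escape | u-partner = ⊥-elim (¬U-minimal (proj₁ (proj₂ (find escape))) u-partner)
      ... | no ¬minˣ | no ¬escape | _ =
            ¬minˣ , All.map (λ {y} → decidable-stable (y ≼? x)) (¬Any⇒All¬ M ¬escape) , refl

      |nonminimals|≤k : length (nonminimals W) ≤ k
      |nonminimals|≤k =
        let y , y∈M , _ = minimals-cover t∈W
            y∈W , minʸ = ∈-filter⁻ (minimal? W) y∈M
        in ≤-pred (≤-trans (filter-notAll (∁? (minimal? W)) W (lose y∈W λ ¬minʸ → ¬minʸ minʸ)) |W|≤)

      nonminimals-closed : PartnerClosed k (nonminimals W)
      nonminimals-closed x∈ ux =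
        let x∈W , _ = ∈-filter⁻ (∁? (minimal? W)) x∈
        in subst U (proj₂ (proj₂ (climb x∈W ux))) (closed x∈W ux)

      t≼u : t ≼ u
      t≼u with minimal? W t
      ... | yes minᵗ = All.lookup (proj₁ (proj₂ (climb u∈W uu))) (∈-filter⁺ (minimal? W) t∈W minᵗ)
      ... | no ¬minᵗ =
            partner-closed⇒cut k (nonminimals W) |nonminimals|≤k (Unique.filter⁺ (∁? (minimal? W)) uW)
              nonminimals-closed (∈-filter⁺ (∁? (minimal? W)) t∈W ¬minᵗ)
              (∈-filter⁺ (∁? (minimal? W)) u∈W (proj₁ (climb u∈W uu))) ¬ut uu

-- Rows, columns and the (1,0)-counts

uncut-arithmetic : ∀ {l z r} → l ≤ z + 1 + r * 2 → 3 ≤ r → 3 * l ≤ 7 * r + 3 * z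
uncut-arithmetic {l} {z} {r} l≤ 3≤r = begin
  3 * l                ≤⟨ *-monoʳ-≤ 3 l≤ ⟩
  3 * (z + 1 + r * 2)  ≡⟨ expand z r ⟩
  3 + (6 * r + 3 * z)  ≤⟨ +-monoˡ-≤ _ 3≤r ⟩
  r + (6 * r + 3 * z)  ≡⟨ collect r z ⟩
  7 * r + 3 * z        ∎
  where
  open ≤-Reasoning
  expand : ∀ z r → 3 * (z + 1 + r * 2) ≡ 3 + (6 * r + 3 * z)
  expand = solve-∀
  collect : ∀ r z → r + (6 * r + 3 * z) ≡ 7 * r + 3 * z
  collect = solve-∀

module Incidence {m : ℕ} {C : Set} (entry : Fin m → C → Bool) where

  Rows : Set
  Rows = List (Fin m)

  OneZero : Fin m → Fin m → Pred C 0ℓ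
  OneZero i j c = entry i c ≡ true × entry j c ≡ false

  oneZero? : ∀ i j → Decidable (OneZero i j)
  oneZero? i j c = (entry i c ≟ᵇ true) ×-dec (entry j c ≟ᵇ false)

  oneZero-rows-≢ : ∀ {i j c} → OneZero i j c → i ≢ j
  oneZero-rows-≢ (isOne , isZero) refl = not-¬ isOne isZero

  oneZero-cols-≢ : ∀ {i j c c′} → OneZero i j c → OneZero j i c′ → c ≢ c′
  oneZero-cols-≢ (isOne , _) (_ , isZero) refl = not-¬ isOne isZero

  #10 : Fin m → Fin m → List C → ℕ
  #10 i j = count (oneZero? i j)

  F0310-Free : List C → Set
  F0310-Free L = ∀ i j → 3 ≤ #10 i j L → #10 j i L ≡ 0

  F0310-free? : ∀ L → Dec (F0310-Free L)
  F0310-free? L = all? λ i → all? λ j → (3 ≤? #10 i j L) →-dec (#10 j i L ≟ 0)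

  Separates : Rows → C → C → Set
  Separates R c c′ = Any (λ r → entry r c ≢ entry r c′) R

  DistinctOn : Rows → List C → Set
  DistinctOn R = AllPairs (Separates R)

  distinctOn? : ∀ R L → Dec (DistinctOn R L)
  distinctOn? R = allPairs? λ c c′ → any? (λ r → ¬? (entry r c ≟ᵇ entry r c′)) R

  separates-sym : ∀ {R c c′} → Separates R c c′ → Separates R c′ c
  separates-sym = Any.map (_∘ sym)

  ¬separates : ∀ {R c c′} → All (λ r → entry r c ≡ entry r c′) R → ¬ Separates R c c′
  ¬separates same = All¬⇒¬Any (All.map (λ eq ne → ne eq) same)

  ZeroOn FullOn : Rows → Pred C 0ℓ
  ZeroOn R c = All (λ r → entry r c ≡ false) R
  FullOn R c = All (λ r → entry r c ≡ true) R

  zeroOn? : ∀ R → Decidable (ZeroOn R)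
  zeroOn? R c = All.all? (λ r → entry r c ≟ᵇ false) R

  fullOn? : ∀ R → Decidable (FullOn R)
  fullOn? R c = All.all? (λ r → entry r c ≟ᵇ true) R

  zeros : Rows → List C → ℕ
  zeros R = count (zeroOn? R)

  _≼[_]_ : Fin m → List C → Fin m → Set
  i ≼[ L ] j = All (λ c → entry i c ≡ true → entry j c ≡ true) L

  ≼-isDecPreorder : ∀ L → IsDecPreorder _≡_ (_≼[ L ]_)
  ≼-isDecPreorder L = record
    { isPreorder = record
      { isEquivalence = isEquivalence
      ; reflexive = λ { refl → All.tabulate λ _ → id }
      ; trans = λ i≼j j≼k → All.zipWith (λ (f , g) → g ∘ f) (i≼j , j≼k)
      }
    ; _≟_ = _≟ᶠ_
    ; _≲?_ = λ i j → All.all? (λ c → (entry i c ≟ᵇ true) →-dec (entry j c ≟ᵇ true)) L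
    }

  ≼⇒#10≡0 : ∀ {i j L} → i ≼[ L ] j → #10 i j L ≡ 0
  ≼⇒#10≡0 {i} {j} i≼j =
    cong length (filter-none (oneZero? i j) (All.map (λ imp (isOne , isZero) → not-¬ (imp isOne) isZero) i≼j))

  #10≡0⇒≼ : ∀ {i j L} → #10 i j L ≡ 0 → i ≼[ L ] j
  #10≡0⇒≼ {i} {j} {L} #10≡0 =
    All.map (λ ¬oneZero isOne → ¬-not (λ isZero → ¬oneZero (isOne , isZero)))
            (count≡0⇒All¬ (oneZero? i j) L #10≡0)

  #10≤2 : ∀ {i j L} → F0310-Free L → (j ≼[ L ] i → i ≼[ L ] j) → #10 i j L ≤ 2
  #10≤2 {i} {j} {L} free not-below with #10 i j L ≤? 2
  ... | yes ≤2 = ≤2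
  ... | no ≰2 = let ≥3 = ≰⇒> ≰2 in
    ⊥-elim (n≮0 (subst (3 ≤_) (≼⇒#10≡0 (not-below (#10≡0⇒≼ (free i j ≥3)))) ≥3))

  F0310-Free-⊆ : ∀ {L′ L} → L′ ⊆ L → F0310-Free L → F0310-Free L′
  F0310-Free-⊆ {L′} {L} L′⊆L free i j 3≤#10 = n≤0⇒n≡0 (begin
    #10 j i L′  ≤⟨ count-⊆ (oneZero? j i) L′⊆L ⟩
    #10 j i L   ≡⟨ free i j (≤-trans 3≤#10 (count-⊆ (oneZero? i j) L′⊆L)) ⟩
    0           ∎)
    where open ≤-Reasoning

  zeros-[] : ∀ L → zeros [] L ≡ length L
  zeros-[] L = cong length (filter-all (zeroOn? []) {xs = L} (All.tabulate λ _ → []))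

  zeros≤1 : ∀ {R L} → DistinctOn R L → zeros R L ≤ 1
  zeros≤1 {R} = count≤1 (zeroOn? R) λ z z′ →
    ¬separates (All.zipWith (λ (p , q) → trans p (sym q)) (z , z′))

  fulls≤1 : ∀ {R L} → DistinctOn R L → count (fullOn? R) L ≤ 1
  fulls≤1 {R} = count≤1 (fullOn? R) λ f f′ →
    ¬separates (All.zipWith (λ (p , q) → trans p (sym q)) (f , f′))

  length≤2^ : ∀ R {L} → DistinctOn R L → length L ≤ 2 ^ length R
  length≤2^ [] [] = z≤n
  length≤2^ [] (_ ∷ []) = ≤-refl
  length≤2^ [] ((() ∷ _) ∷ _)
  length≤2^ (r ∷ R) {L} distinct = begin
    length L                          ≡⟨ count-partition one? L ⟩
    count one? L + count (∁? one?) L  ≤⟨ +-mono-≤ (half one? λ p p′ → trans p (sym p′))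
                                                  (half (∁? one?) λ p p′ → trans (¬-not p) (sym (¬-not p′))) ⟩
    2 ^ length R + 2 ^ length R       ≡⟨ cong (2 ^ length R +_) (+-identityʳ _) ⟨
    2 ^ length (r ∷ R)                ∎
    where
    open ≤-Reasoning
    one? : Decidable (λ c → entry r c ≡ true)
    one? c = entry r c ≟ᵇ true
    drop-r : ∀ {c c′} → entry r c ≡ entry r c′ → Separates (r ∷ R) c c′ → Separates R c c′
    drop-r same (here differ) = ⊥-elim (differ same)
    drop-r _ (there separates) = separates
    half : ∀ {P : Pred C 0ℓ} (P? : Decidable P) → (∀ {c c′} → P c → P c′ → entry r c ≡ entry r c′) →
           count P? L ≤ 2 ^ length R
    half P? same = length≤2^ R
      (AllPairs-restrict (all-filter P? L) (λ p p′ → drop-r (same p p′)) (AllPairs.filter⁺ P? distinct))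

  -- Carrying 3 · zeros rather than the constant 3 is what lets the split below add up:
  -- only the upper half can contain a column vanishing on its rows.
  Bound : Rows → List C → Set
  Bound R L = 3 * length L ≤ 7 * length R + 3 * zeros R L

  module Split {R : Rows} {L : List C} {S : Pred (Fin m) 0ℓ} (S? : Decidable S)
               (cut : ∀ {t u} → t ∈ R → u ∈ R → ¬ S t → S u → t ≼[ L ] u) where

    upper lower : Rows
    upper = filter S? R
    lower = filter (∁? S?) R

    Lᵘ Lˡ : List C
    Lᵘ = filter (zeroOn? lower) L
    Lˡ = filter (∁? (zeroOn? lower)) L

    one-above-lower : ∀ {c u} → c ∈ L → ¬ ZeroOn lower c → u ∈ R → S u → entry u c ≡ true
    one-above-lower c∈L ¬zero u∈R su =
      let t , t∈lower , t-nonzero = find (¬All⇒Any¬ (λ r → _ ≟ᵇ false) lower ¬zero)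
          t∈R , ¬st = ∈-filter⁻ (∁? S?) t∈lower
      in All.lookup (cut t∈R u∈R ¬st su) c∈L (¬-not t-nonzero)

    distinct-upper : DistinctOn R L → DistinctOn upper Lᵘ
    distinct-upper distinct =
      AllPairs-restrict (all-filter (zeroOn? lower) L) separated-above (AllPairs.filter⁺ (zeroOn? lower) distinct)
      where
      separated-above : ∀ {c c′} → ZeroOn lower c → ZeroOn lower c′ → Separates R c c′ → Separates upper c c′
      separated-above z z′ = Any-filter⁺ S? λ {r} r∈R differ → decidable-stable (S? r) λ ¬sr →
        let r∈lower = ∈-filter⁺ (∁? S?) r∈R ¬sr
        in differ (trans (All.lookup z r∈lower) (sym (All.lookup z′ r∈lower)))

    distinct-lower : DistinctOn R L → DistinctOn lower Lˡ
    distinct-lower distinct =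
      AllPairs-restrict (All.tabulate (∈-filter⁻ (∁? (zeroOn? lower)) {xs = L})) separated-below
        (AllPairs.filter⁺ (∁? (zeroOn? lower)) distinct)
      where
      separated-below : ∀ {c c′} → c ∈ L × ¬ ZeroOn lower c → c′ ∈ L × ¬ ZeroOn lower c′ →
                        Separates R c c′ → Separates lower c c′
      separated-below (c∈L , nz) (c′∈L , nz′) = Any-filter⁺ (∁? S?) λ r∈R differ sr →
        differ (trans (one-above-lower c∈L nz r∈R sr) (sym (one-above-lower c′∈L nz′ r∈R sr)))

    zeros-upper : zeros upper Lᵘ ≤ zeros R L
    zeros-upper = begin
      zeros upper Lᵘ  ≤⟨ count-mono (zeroOn? upper) (zeroOn? R) Lᵘ (λ c∈Lᵘ →
                            zero-everywhere (proj₂ (∈-filter⁻ (zeroOn? lower) {xs = L} c∈Lᵘ))) ⟩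
      zeros R Lᵘ      ≤⟨ count-⊆ (zeroOn? R) (filter-⊆ (zeroOn? lower) L) ⟩
      zeros R L       ∎
      where
      open ≤-Reasoning
      zero-everywhere : ∀ {c} → ZeroOn lower c → ZeroOn upper c → ZeroOn R c
      zero-everywhere zˡ zᵘ = All.tabulate λ {r} r∈R → case S? r of λ where
        (yes sr) → All.lookup zᵘ (∈-filter⁺ S? r∈R sr)
        (no ¬sr) → All.lookup zˡ (∈-filter⁺ (∁? S?) r∈R ¬sr)

    zeros-lower : zeros lower Lˡ ≡ 0
    zeros-lower =
      cong length (filter-none (zeroOn? lower) (All.tabulate (proj₂ ∘ ∈-filter⁻ (∁? (zeroOn? lower)) {xs = L})))

    split-bound : Bound upper Lᵘ → Bound lower Lˡ → Bound R L
    split-bound boundᵘ boundˡ = begin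
      3 * length L                                     ≡⟨ cong (3 *_) (count-partition (zeroOn? lower) L) ⟩
      3 * (length Lᵘ + length Lˡ)                      ≡⟨ *-distribˡ-+ 3 (length Lᵘ) _ ⟩
      3 * length Lᵘ + 3 * length Lˡ                    ≤⟨ +-mono-≤ boundᵘ boundˡ ⟩
      (7 * u + 3 * zeros upper Lᵘ) + (7 * l + 3 * zeros lower Lˡ)
                                                       ≤⟨ +-mono-≤ (+-monoʳ-≤ (7 * u) (*-monoʳ-≤ 3 zeros-upper))
                                                                   (≤-reflexive (cong ((7 * l +_) ∘ (3 *_)) zeros-lower)) ⟩
      (7 * u + 3 * zeros R L) + (7 * l + 3 * 0)        ≡⟨ regroup u l (zeros R L) ⟩
      7 * (u + l) + 3 * zeros R L                      ≡⟨ cong (λ n → 7 * n + 3 * zeros R L) (count-partition S? R) ⟨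
      7 * length R + 3 * zeros R L                     ∎
      where
      open ≤-Reasoning
      u = length upper
      l = length lower
      regroup : ∀ u l z → (7 * u + 3 * z) + (7 * l + 3 * 0) ≡ 7 * (u + l) + 3 * z
      regroup = solve-∀

  module Partner (R : Rows) (L : List C) where

    open MinimalLayers (≼-isDecPreorder L) using (partner; partner-not-below; partner-closed⇒cut)

    partner-row : Fin m → Fin m
    partner-row = partner (length R) R

    Closed : Pred C 0ℓ
    Closed c = All (λ x → entry x c ≡ true → entry (partner-row x) c ≡ true) R

    Cutting : Pred C 0ℓ
    Cutting c = ¬ ZeroOn R c × ¬ FullOn R c × Closed c

    cutting? : Decidable Cutting
    cutting? c = ¬? (zeroOn? R c) ×-dec ¬? (fullOn? R c) ×-dec
                 All.all? (λ x → (entry x c ≟ᵇ true) →-dec (entry (partner-row x) c ≟ᵇ true)) R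

    closed⇒cut : Unique R → ∀ {c} → c ∈ L → Closed c →
                 ∀ {t u} → t ∈ R → u ∈ R → entry t c ≢ true → entry u c ≡ true → t ≼[ L ] u
    closed⇒cut uR {c} c∈L closed = partner-closed⇒cut (λ r → entry r c ≡ true) (λ x≼y → All.lookup x≼y c∈L)
                                                      (length R) R ≤-refl uR (All.lookup closed)

    uncut-length : DistinctOn R L → F0310-Free L → All (¬_ ∘ Cutting) L →
                   length L ≤ zeros R L + 1 + length R * 2
    uncut-length distinct free uncut = begin
      length L                                        ≡⟨ count-partition (zeroOn? R) L ⟩
      zeros R L + length L₁                           ≡⟨ cong (zeros R L +_) (count-partition (fullOn? R) L₁) ⟩
      zeros R L + (count (fullOn? R) L₁ + length L₂)  ≤⟨ +-monoʳ-≤ (zeros R L)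
                                                           (+-mono-≤ (fulls≤1 (AllPairs.filter⁺ _ distinct)) L₂-bound) ⟩
      zeros R L + (1 + length R * 2)                  ≡⟨ +-assoc (zeros R L) 1 _ ⟨
      zeros R L + 1 + length R * 2                    ∎
      where
      open ≤-Reasoning
      L₁ L₂ : List C
      L₁ = filter (∁? (zeroOn? R)) L
      L₂ = filter (∁? (fullOn? R)) L₁
      broken : ∀ {c} → c ∈ L₂ → Any (λ x → OneZero x (partner-row x) c) R
      broken c∈L₂ =
        let c∈L₁ , ¬full = ∈-filter⁻ (∁? (fullOn? R)) {xs = L₁} c∈L₂
            c∈L , ¬zero = ∈-filter⁻ (∁? (zeroOn? R)) {xs = L} c∈L₁
            ¬closed = λ closed → All.lookup uncut c∈L (¬zero , ¬full , closed)
        in Any.map ¬[⇒true]⇒true-false (¬All⇒Any¬ (λ x → (_ ≟ᵇ true) →-dec (_ ≟ᵇ true)) R ¬closed)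
      L₂⊆L : L₂ ⊆ L
      L₂⊆L = ⊆-trans (filter-⊆ _ L₁) (filter-⊆ _ L)
      L₂-bound : length L₂ ≤ length R * 2
      L₂-bound = cover-length≤ (λ x → oneZero? x (partner-row x)) 2 R L₂
        (λ {x} x∈R → ≤-trans (count-⊆ (oneZero? x (partner-row x)) L₂⊆L)
                             (#10≤2 free (partner-not-below (length R) R x∈R)))
        (All.tabulate broken)

  Bounded : ℕ → Set
  Bounded fuel = ∀ R L → length R ≤ fuel → Unique R → DistinctOn R L → F0310-Free L → Bound R L

  cut-bound : ∀ {fuel R L c} → Bounded fuel → length R ≤ suc fuel → Unique R → DistinctOn R L → F0310-Free L →
              c ∈ L → Partner.Cutting R L c → Bound R L
  cut-bound {fuel} {R} {L} {c} bounded |R|≤ uR distinct free c∈L (¬zero , ¬full , closed) =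
    split-bound
      (bounded upper Lᵘ |upper|≤ (Unique.filter⁺ S? uR) (distinct-upper distinct) (free-on (zeroOn? lower)))
      (bounded lower Lˡ |lower|≤ (Unique.filter⁺ (∁? S?) uR) (distinct-lower distinct) (free-on (∁? (zeroOn? lower))))
    where
    free-on : ∀ {Q : Pred C 0ℓ} (Q? : Decidable Q) → F0310-Free (filter Q? L)
    free-on Q? = F0310-Free-⊆ (filter-⊆ Q? L) free
    S? : Decidable (λ r → entry r c ≡ true)
    S? r = entry r c ≟ᵇ true
    open Split S? (Partner.closed⇒cut R L uR c∈L closed)
    |upper|≤ : length upper ≤ fuel
    |upper|≤ = ≤-pred (≤-trans (filter-notAll S? R (¬All⇒Any¬ S? R ¬full)) |R|≤)
    |lower|≤ : length lower ≤ fuel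
    |lower|≤ = ≤-pred (≤-trans (filter-notAll (∁? S?) R (Any.map (λ nonzero ¬one → nonzero (¬-not ¬one))
                                  (¬All⇒Any¬ (λ r → entry r c ≟ᵇ false) R ¬zero))) |R|≤)

  bound : ∀ fuel → Bounded fuel
  bound _ [] L _ _ _ _ = ≤-reflexive (cong (3 *_) (sym (zeros-[] L)))
  bound _ R@(_ ∷ []) _ _ _ distinct _ =
    ≤-trans (*-monoʳ-≤ 3 (length≤2^ R distinct)) (m≤n⇒m≤n+o _ (m≤m+n 6 1))
  bound _ R@(_ ∷ _ ∷ []) _ _ _ distinct _ =
    ≤-trans (*-monoʳ-≤ 3 (length≤2^ R distinct)) (m≤n⇒m≤n+o _ (m≤m+n 12 2))
  bound zero (_ ∷ _ ∷ _ ∷ _) _ ()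
  bound (suc fuel) R@(_ ∷ _ ∷ _ ∷ _) L |R|≤ uR distinct free with any? (Partner.cutting? R L) L
  ... | yes cutting = let _ , c∈L , cuts = find cutting in cut-bound (bound fuel) |R|≤ uR distinct free c∈L cuts
  ... | no ¬cutting = uncut-arithmetic {r = length R}
                        (Partner.uncut-length R L distinct free (¬Any⇒All¬ L ¬cutting)) (s≤s (s≤s (s≤s z≤n)))

-- From matrices to column lists and back

module MatrixAvoidance {m n : ℕ} (A : Matrix m n) where

  open Incidence A

  simple⇒distinct : Simple A → DistinctOn (allFin m) (allFin n)
  simple⇒distinct simple = AllPairs.map separated (Unique.allFin⁺ n)
    where
    separated : ∀ {c c′} → c ≢ c′ → Separates (allFin m) c c′
    separated {c} {c′} c≢c′ = ¬All⇒Any¬ (λ r → A r c ≟ᵇ A r c′) (allFin m)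
      λ same → c≢c′ (simple c c′ λ r → All.lookup same (∈-allFin r))

  ≺-witness : ∀ {i j c₄} cs → Unique cs → All (OneZero i j) cs → 3 ≤ length cs → OneZero j i c₄ →
              F0310 ≺ A
  ≺-witness [] _ _ ()
  ≺-witness (_ ∷ []) _ _ (s≤s ())
  ≺-witness (_ ∷ _ ∷ []) _ _ (s≤s (s≤s ()))
  ≺-witness {i} {j} {c₄} (c₁ ∷ c₂ ∷ c₃ ∷ _) ((c₁≢c₂ ∷ c₁≢c₃ ∷ _) ∷ (c₂≢c₃ ∷ _) ∷ _) (p₁ ∷ p₂ ∷ p₃ ∷ _) _ p₄ =
    ρ , γ , (λ {x} {y} → VecUnique.lookup-injective ρ-unique x y) ,
            (λ {x} {y} → VecUnique.lookup-injective γ-unique x y) , entries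
    where
    ρ = Vec.lookup (i ∷ j ∷ [])
    γ = Vec.lookup (c₁ ∷ c₂ ∷ c₃ ∷ c₄ ∷ [])
    ρ-unique = (oneZero-rows-≢ p₁ ∷ []) ∷ [] ∷ []
    γ-unique = (c₁≢c₂ ∷ c₁≢c₃ ∷ oneZero-cols-≢ p₁ p₄ ∷ []) ∷ (c₂≢c₃ ∷ oneZero-cols-≢ p₂ p₄ ∷ []) ∷
               (oneZero-cols-≢ p₃ p₄ ∷ []) ∷ [] ∷ []
    entries : ∀ r c → F0310 r c ≡ A (ρ r) (γ c)
    entries zero zero = sym (proj₁ p₁)
    entries zero (suc zero) = sym (proj₁ p₂)
    entries zero (suc (suc zero)) = sym (proj₁ p₃)
    entries zero (suc (suc (suc zero))) = sym (proj₂ p₄)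
    entries (suc zero) zero = sym (proj₂ p₁)
    entries (suc zero) (suc zero) = sym (proj₂ p₂)
    entries (suc zero) (suc (suc zero)) = sym (proj₂ p₃)
    entries (suc zero) (suc (suc (suc zero))) = sym (proj₁ p₄)

  ¬≺⇒free : ¬ F0310 ≺ A → F0310-Free (allFin n)
  ¬≺⇒free ¬≺ i j 3≤#10 with filter (oneZero? j i) (allFin n) | all-filter (oneZero? j i) (allFin n)
  ... | [] | _ = refl
  ... | _ ∷ _ | p₄ ∷ _ = ⊥-elim (¬≺ (≺-witness (filter (oneZero? i j) (allFin n))
                                       (Unique.filter⁺ (oneZero? i j) (Unique.allFin⁺ n))
                                       (all-filter (oneZero? i j) (allFin n)) 3≤#10 p₄))

  free⇒¬≺ : F0310-Free (allFin n) → ¬ F0310 ≺ A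
  free⇒¬≺ free (ρ , γ , _ , γ-injective , entries) = <-irrefl (sym (free i j three)) one-column-01
    where
    i = ρ (# 0)
    j = ρ (# 1)
    one-column-01 : 0 < #10 j i (allFin n)
    one-column-01 =
      filter-some (oneZero? j i) (lose (∈-allFin (γ (# 3))) (sym (entries (# 1) (# 3)) , sym (entries (# 0) (# 3))))
    member : ∀ k → F0310 (# 0) k ≡ true → F0310 (# 1) k ≡ false → γ k ∈ filter (oneZero? i j) (allFin n)
    member k isOne isZero = ∈-filter⁺ (oneZero? i j) (∈-allFin (γ k))
                              (trans (sym (entries (# 0) k)) isOne , trans (sym (entries (# 1) k)) isZero)
    three : 3 ≤ #10 i j (allFin n)
    three = Unique⇒length≤ _≟ᶠ_ {xs = γ (# 0) ∷ γ (# 1) ∷ γ (# 2) ∷ []}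
      (((λ ()) ∘ γ-injective ∷ (λ ()) ∘ γ-injective ∷ []) ∷ ((λ ()) ∘ γ-injective ∷ []) ∷ [] ∷ [])
      λ where
        (here refl) → member (# 0) refl refl
        (there (here refl)) → member (# 1) refl refl
        (there (there (here refl))) → member (# 2) refl refl

n≤7m/3+1 : ∀ {m n} → 3 * n ≤ 7 * m + 3 → n ≤ 7 * m / 3 + 1
n≤7m/3+1 {m} {n} 3n≤7m+3 = begin
  n                ≡⟨ m*n/n≡m n 3 ⟨
  n * 3 / 3        ≤⟨ /-monoˡ-≤ 3 (≤-trans (≤-reflexive (*-comm n 3)) 3n≤7m+3) ⟩
  (7 * m + 3) / 3  ≡⟨ +-distrib-/-∣ʳ (7 * m) (divides-refl 1) ⟩
  7 * m / 3 + 1    ∎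
  where open ≤-Reasoning

upper-bound : ∀ {m n} (A : Matrix m n) → Avoids F0310 A → n ≤ 7 * m / 3 + 1
upper-bound {m} {n} A (simple , ¬≺) = n≤7m/3+1 {m} (begin
  3 * n                                                    ≡⟨ cong (3 *_) (length-allFin n) ⟨
  3 * length (allFin n)                                    ≤⟨ bound m (allFin m) (allFin n)
                                                                (≤-reflexive (length-allFin m)) (Unique.allFin⁺ m)
                                                                distinct (¬≺⇒free ¬≺) ⟩
  7 * length (allFin m) + 3 * zeros (allFin m) (allFin n)  ≤⟨ +-mono-≤ (≤-reflexive (cong (7 *_) (length-allFin m)))
                                                                      (*-monoʳ-≤ 3 (zeros≤1 distinct)) ⟩
  7 * m + 3                                                ∎)
  where
  open ≤-Reasoning
  open Incidence A
  open MatrixAvoidance A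
  distinct = simple⇒distinct simple
  length-allFin : ∀ k → length (allFin k) ≡ k
  length-allFin k = length-tabulate {n = k} id

Column : ℕ → Set
Column m = Fin m → Bool

module Columns {m : ℕ} = Incidence {m} {Column m} (λ r c → c r)
open Columns

fromColumns : ∀ {m} (cs : List (Column m)) → Matrix m (length cs)
fromColumns cs r k = lookup cs k r

#10-fromColumns : ∀ {m} (cs : List (Column m)) i j →
                  Incidence.#10 (fromColumns cs) i j (allFin (length cs)) ≡ #10 i j cs
#10-fromColumns cs i j = begin
  count (oneZero? i j ∘ lookup cs) (allFin (length cs))        ≡⟨ count-map (oneZero? i j) (lookup cs) (allFin _) ⟨
  count (oneZero? i j) (map (lookup cs) (allFin (length cs)))  ≡⟨ cong (count (oneZero? i j)) columns-of-lookup ⟩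
  #10 i j cs                                                   ∎
  where
  open ≡-Reasoning
  columns-of-lookup : map (lookup cs) (allFin (length cs)) ≡ cs
  columns-of-lookup = trans (map-tabulate id (lookup cs)) (tabulate-lookup cs)

simple-fromColumns : ∀ {m} {cs : List (Column m)} → DistinctOn (allFin m) cs → Simple (fromColumns cs)
simple-fromColumns (_ ∷ _) zero zero _ = refl
simple-fromColumns (sep ∷ _) zero (suc k) same =
  ⊥-elim (¬separates (All.tabulate λ {r} _ → same r) (All.lookup sep (∈-lookup k)))
simple-fromColumns (sep ∷ _) (suc k) zero same =
  ⊥-elim (¬separates (All.tabulate λ {r} _ → sym (same r)) (All.lookup sep (∈-lookup k)))
simple-fromColumns (_ ∷ distinct) (suc k) (suc k′) same = cong suc (simple-fromColumns distinct k k′ same)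

avoids-fromColumns : ∀ {m} {cs : List (Column m)} → DistinctOn (allFin m) cs → F0310-Free cs →
                     Avoids F0310 (fromColumns cs)
avoids-fromColumns {cs = cs} distinct free =
  simple-fromColumns distinct ,
  MatrixAvoidance.free⇒¬≺ (fromColumns cs) λ i j 3≤#10 →
    trans (#10-fromColumns cs j i) (free i j (subst (3 ≤_) (#10-fromColumns cs i j) 3≤#10))

-- The construction

#10-map : ∀ {m m′} (f : Column m → Column m′) {i j : Fin m′} {i′ j′ : Fin m} →
          (∀ c → f c i ≡ c i′) → (∀ c → f c j ≡ c j′) → ∀ cs → #10 i j (map f cs) ≡ #10 i′ j′ cs
#10-map f {i} {j} {i′} {j′} fi fj cs = trans (count-map (oneZero? i j) f cs) (cong length (filter-≐ _ (oneZero? i′ j′)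
    ((λ {c} (isOne , isZero) → trans (sym (fi c)) isOne , trans (sym (fj c)) isZero) ,
     (λ {c} (isOne , isZero) → trans (fi c) isOne , trans (fj c) isZero))
    cs))

0ᶜ 1ᶜ : ∀ {m} → Column m
0ᶜ _ = false
1ᶜ _ = true

unit : ∀ {m} → Fin m → Column m
unit r r′ = does (r ≟ᶠ r′)

extremal : ∀ m → List (Column m)
extremal m = 0ᶜ ∷ map unit (allFin m) ++ map (λ r → not ∘ unit r) (allFin m)

_⊕_ : ∀ {k m} → Column k → Column m → Column (k + m)
_⊕_ {k} a b = [ a , b ]′ ∘ splitAt k

⊕-↑ˡ : ∀ {k m} (a : Column k) (b : Column m) r → (a ⊕ b) (r ↑ˡ m) ≡ a r
⊕-↑ˡ {k} {m} a b r = cong [ a , b ]′ (splitAt-↑ˡ k r m)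

⊕-↑ʳ : ∀ {k m} (a : Column k) (b : Column m) r → (a ⊕ b) (k ↑ʳ r) ≡ b r
⊕-↑ʳ {k} {m} a b r = cong [ a , b ]′ (splitAt-↑ʳ k m r)

⊕-separatesˡ : ∀ {k m} {a a′ : Column k} {b b′ : Column m} →
               Separates (allFin k) a a′ → Separates (allFin (k + m)) (a ⊕ b) (a′ ⊕ b′)
⊕-separatesˡ {m = m} {a} {a′} {b} {b′} sep = let r , differ = Any.satisfied sep in
  Any.tabulate⁺ (r ↑ˡ m) λ same → differ (trans (sym (⊕-↑ˡ a b r)) (trans same (⊕-↑ˡ a′ b′ r)))

⊕-separatesʳ : ∀ {k m} {a a′ : Column k} {b b′ : Column m} →
               Separates (allFin m) b b′ → Separates (allFin (k + m)) (a ⊕ b) (a′ ⊕ b′)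
⊕-separatesʳ {k} {a = a} {a′} {b} {b′} sep = let r , differ = Any.satisfied sep in
  Any.tabulate⁺ (k ↑ʳ r) λ same → differ (trans (sym (⊕-↑ʳ a b r)) (trans same (⊕-↑ʳ a′ b′ r)))

data Block (k m : ℕ) : Fin (k + m) → Set where
  top : ∀ s → Block k m (s ↑ˡ m)
  bottom : ∀ r → Block k m (k ↑ʳ r)

block : ∀ k {m} i → Block k m i
block zero i = bottom i
block (suc k) zero = top zero
block (suc k) (suc i) with block k i
... | top s = top (suc s)
... | bottom r = bottom r

extremal-distinct : DistinctOn (allFin 3) (1ᶜ ∷ extremal 3)
extremal-distinct = from-yes (distinctOn? (allFin 3) (1ᶜ ∷ extremal 3))

extremal-#10≤2 : ∀ s t → #10 s t (extremal 3) ≤ 2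
extremal-#10≤2 = from-yes (all? λ s → all? λ t → #10 s t (extremal 3) ≤? 2)

grow : ∀ {m} → List (Column m) → List (Column (3 + m))
grow cs = map (_⊕ 0ᶜ) (extremal 3) ++ map (1ᶜ ⊕_) cs

module Grow {m : ℕ} (cs : List (Column m)) where

  new old : List (Column (3 + m))
  new = map (_⊕ 0ᶜ) (extremal 3)
  old = map (1ᶜ ⊕_) cs

  top-entry : ∀ (a : Column 3) (b : Column m) s → (a ⊕ b) (s ↑ˡ m) ≡ a s
  top-entry = ⊕-↑ˡ

  bottom-entry : ∀ (a : Column 3) (b : Column m) r → (a ⊕ b) (3 ↑ʳ r) ≡ b r
  bottom-entry = ⊕-↑ʳ

  #10-grow : ∀ i j → #10 i j (grow cs) ≡ #10 i j new + #10 i j old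
  #10-grow i j = count-++ (oneZero? i j) new old

  grow-length : length (grow cs) ≡ 7 + length cs
  grow-length = trans (length-++ new {old}) (cong (7 +_) (length-map (_⊕_ {3} 1ᶜ) cs))

  bottom-of-new : ∀ r {j} → (3 ↑ʳ r) ≼[ new ] j
  bottom-of-new r =
    All.map⁺ {f = _⊕ 0ᶜ} (All.tabulate λ {a} _ isOne → ⊥-elim (not-¬ isOne (bottom-entry a 0ᶜ r)))

  top-of-old : ∀ {i} s → i ≼[ old ] (s ↑ˡ m)
  top-of-old s = All.map⁺ {f = 1ᶜ ⊕_} (All.tabulate λ {c} _ _ → top-entry 1ᶜ c s)

  bottom≼top : ∀ r s → (3 ↑ʳ r) ≼[ grow cs ] (s ↑ˡ m)
  bottom≼top r s = All.++⁺ (bottom-of-new r) (top-of-old s)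

  #10-top : ∀ s t → #10 (s ↑ˡ m) (t ↑ˡ m) (grow cs) ≤ 2
  #10-top s t = begin
    #10 (s ↑ˡ m) (t ↑ˡ m) (grow cs)                        ≡⟨ #10-grow (s ↑ˡ m) (t ↑ˡ m) ⟩
    #10 (s ↑ˡ m) (t ↑ˡ m) new + #10 (s ↑ˡ m) (t ↑ˡ m) old  ≡⟨ cong₂ _+_ new-part (≼⇒#10≡0 (top-of-old t)) ⟩
    #10 s t (extremal 3) + 0                               ≤⟨ +-monoˡ-≤ 0 (extremal-#10≤2 s t) ⟩
    2                                                      ∎
    where
    open ≤-Reasoning
    new-part = #10-map (_⊕ 0ᶜ) {s ↑ˡ m} {t ↑ˡ m} (λ a → top-entry a 0ᶜ s) (λ a → top-entry a 0ᶜ t) (extremal 3)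

  #10-bottom : ∀ r r′ → #10 (3 ↑ʳ r) (3 ↑ʳ r′) (grow cs) ≡ #10 r r′ cs
  #10-bottom r r′ = trans (#10-grow (3 ↑ʳ r) (3 ↑ʳ r′)) (cong₂ _+_ (≼⇒#10≡0 (bottom-of-new r {3 ↑ʳ r′})) old-part)
    where
    old-part = #10-map (1ᶜ ⊕_) {3 ↑ʳ r} {3 ↑ʳ r′} (λ c → bottom-entry 1ᶜ c r) (λ c → bottom-entry 1ᶜ c r′) cs

  grow-free : F0310-Free cs → F0310-Free (grow cs)
  grow-free free i j with block 3 i | block 3 j
  ... | top s | top t = λ 3≤#10 → ⊥-elim (<⇒≱ 3≤#10 (#10-top s t))
  ... | top s | bottom r = λ _ → ≼⇒#10≡0 (bottom≼top r s)
  ... | bottom r | top t = λ 3≤#10 → ⊥-elim (n≮0 (subst (3 ≤_) (≼⇒#10≡0 (bottom≼top r t)) 3≤#10))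
  ... | bottom r | bottom r′ =
        λ 3≤#10 → trans (#10-bottom r′ r) (free r r′ (subst (3 ≤_) (#10-bottom r r′) 3≤#10))

  grow-distinct : DistinctOn (allFin m) cs → DistinctOn (allFin (3 + m)) (grow cs)
  grow-distinct distinct with extremal-distinct
  ... | separated-from-1 ∷ distinct-extremal =
    AllPairs.++⁺ (AllPairs.map⁺ (AllPairs.map (⊕-separatesˡ {b = 0ᶜ} {0ᶜ}) distinct-extremal))
                 (AllPairs.map⁺ (AllPairs.map (⊕-separatesʳ {a = 1ᶜ} {1ᶜ}) distinct))
                 (All.map⁺ (All.map (λ sep → All.map⁺ (All.tabulate λ {c} _ →
                                                   ⊕-separatesˡ {b = 0ᶜ} {c} (separates-sym sep)))
                                    separated-from-1))

open Grow using (grow-length; grow-free; grow-distinct)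

-- For m = 3, 4, 5 the list 1ᶜ ∷ extremal m has 2m + 2 = ⌊7m/3⌋ + 1 columns, and each growth step
-- adds three rows and seven columns, matching ⌊7(m + 3)/3⌋ = ⌊7m/3⌋ + 7.
construction : ∀ k → List (Column (3 + k))
construction 0 = 1ᶜ ∷ extremal 3
construction 1 = 1ᶜ ∷ extremal 4
construction 2 = 1ᶜ ∷ extremal 5
construction (suc (suc (suc k))) = grow (construction k)

construction-length : ∀ k → length (construction k) ≡ 7 * (3 + k) / 3 + 1
construction-length 0 = refl
construction-length 1 = refl
construction-length 2 = refl
construction-length (suc (suc (suc k))) = begin
  length (grow (construction k))   ≡⟨ grow-length (construction k) ⟩
  7 + length (construction k)      ≡⟨ cong (7 +_) (construction-length k) ⟩
  7 + (7 * (3 + k) / 3 + 1)        ≡⟨ +-assoc 7 _ 1 ⟨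
  7 + 7 * (3 + k) / 3 + 1          ≡⟨ cong (_+ 1) (+-comm 7 (7 * (3 + k) / 3)) ⟩
  7 * (3 + k) / 3 + 7 * 3 / 3 + 1  ≡⟨ cong (_+ 1) (+-distrib-/-∣ʳ (7 * (3 + k)) {d = 3} (divides-refl 7)) ⟨
  (7 * (3 + k) + 7 * 3) / 3 + 1    ≡⟨ cong (λ n → n / 3 + 1) (*-distribˡ-+ 7 (3 + k) 3) ⟨
  7 * (3 + k + 3) / 3 + 1          ≡⟨ cong (λ n → 7 * n / 3 + 1) (+-comm (3 + k) 3) ⟩
  7 * (3 + (3 + k)) / 3 + 1        ∎
  where open ≡-Reasoning

construction-distinct : ∀ k → DistinctOn (allFin (3 + k)) (construction k)
construction-distinct 0 = extremal-distinct
construction-distinct 1 = from-yes (distinctOn? (allFin 4) (construction 1))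
construction-distinct 2 = from-yes (distinctOn? (allFin 5) (construction 2))
construction-distinct (suc (suc (suc k))) = grow-distinct (construction k) (construction-distinct k)

construction-free : ∀ k → F0310-Free (construction k)
construction-free 0 = from-yes (F0310-free? (construction 0))
construction-free 1 = from-yes (F0310-free? (construction 1))
construction-free 2 = from-yes (F0310-free? (construction 2))
construction-free (suc (suc (suc k))) = grow-free (construction k) (construction-free k)

lower-bound : ∀ m → 3 ≤ m → Σ (Matrix m (7 * m / 3 + 1)) (Avoids F0310)
lower-bound 1 (s≤s ())
lower-bound 2 (s≤s (s≤s ()))
lower-bound (suc (suc (suc k))) _ =
  subst (λ N → Σ (Matrix (3 + k) N) (Avoids F0310)) (construction-length k)
        (fromColumns (construction k) , avoids-fromColumns (construction-distinct k) (construction-free k))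

theorem5 : ∀ (m : ℕ) → 3 ≤ m → ForbIs m F0310 ((7 * m) / 3 + 1)
theorem5 m 3≤m = lower-bound m 3≤m , λ _ A → upper-bound A
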